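{- Let $\mathbb{B}$ be a regular category. Then the class of regular epimorphisms is a definable class for the codomain fibration $\operatorname{cod}:\mathbb{B}^\to\to\mathbb{B}$.
   Context: A class $\mathcal{D}$ of maps of $\mathbb{B}$ closed under pullback is definable for $\operatorname{cod}$ if the inclusion of the category whose objects are the maps in $\mathcal{D}$ and whose morphisms are pullback squares into the category of all maps of $\mathbb{B}$ with pullback squares as morphisms has a right adjoint; equivalently, for every $f:X\to Y$ there is a monomorphism $U\rightarrowtail Y$ such that for all $g:Z\to Y$, $g^\ast(f)\in\mathcal{D}$ if and only if $g$ factors through $U$. -}

module Defs where

open import Level using (Level; _⊔_; suc)
open import Data.Product using (Σ; Σ-syntax; _×_; _,_)
open import Relation.Binary using (IsEquivalence)
open import Function.Bundles using (_⇔_)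

record Category (o ℓ e : Level) : Set (suc (o ⊔ ℓ ⊔ e)) where
  infixr 9 _∘_
  infix  4 _≈_
  field
    Obj   : Set o
    Hom   : Obj → Obj → Set ℓ
    _≈_   : ∀ {A B} → Hom A B → Hom A B → Set e
    id    : ∀ {A} → Hom A A
    _∘_   : ∀ {A B C} → Hom B C → Hom A B → Hom A C
    ≈-equiv   : ∀ {A B} → IsEquivalence (_≈_ {A} {B})
    ∘-resp-≈  : ∀ {A B C} {f f' : Hom B C} {g g' : Hom A B} →
                f ≈ f' → g ≈ g' → f ∘ g ≈ f' ∘ g'
    assoc     : ∀ {A B C D} {f : Hom C D} {g : Hom B C} {h : Hom A B} →
                (f ∘ g) ∘ h ≈ f ∘ (g ∘ h)
    identityˡ : ∀ {A B} {f : Hom A B} → id ∘ f ≈ f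
    identityʳ : ∀ {A B} {f : Hom A B} → f ∘ id ≈ f

module _ {o ℓ e : Level} (𝔹 : Category o ℓ e) where
  open Category 𝔹

  Mono : ∀ {U Y} → Hom U Y → Set (o ⊔ ℓ ⊔ e)
  Mono {U} m = ∀ {W} (g h : Hom W U) → m ∘ g ≈ m ∘ h → g ≈ h

  record IsPullback {P X Y Z : Obj} (f : Hom X Y) (g : Hom Z Y)
                    (p₁ : Hom P X) (p₂ : Hom P Z) : Set (o ⊔ ℓ ⊔ e) where
    field
      commute   : f ∘ p₁ ≈ g ∘ p₂
      universal : ∀ {W} (h₁ : Hom W X) (h₂ : Hom W Z) → f ∘ h₁ ≈ g ∘ h₂ →
                  Σ[ u ∈ Hom W P ] ((p₁ ∘ u ≈ h₁) × (p₂ ∘ u ≈ h₂) ×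
                    (∀ (u' : Hom W P) → p₁ ∘ u' ≈ h₁ → p₂ ∘ u' ≈ h₂ → u' ≈ u))

  record IsCoequalizer {R X Q : Obj} (a b : Hom R X) (q : Hom X Q)
                       : Set (o ⊔ ℓ ⊔ e) where
    field
      equality  : q ∘ a ≈ q ∘ b
      coequalize : ∀ {W} (h : Hom X W) → h ∘ a ≈ h ∘ b →
                   Σ[ u ∈ Hom Q W ] ((u ∘ q ≈ h) ×
                     (∀ (u' : Hom Q W) → u' ∘ q ≈ h → u' ≈ u))

  RegularEpi : ∀ {X Y} → Hom X Y → Set (o ⊔ ℓ ⊔ e)
  RegularEpi {X} {Y} f = Σ[ R ∈ Obj ] Σ[ a ∈ Hom R X ] Σ[ b ∈ Hom R X ]
                           IsCoequalizer a b f

  IsTerminal : Obj → Set (o ⊔ ℓ ⊔ e)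
  IsTerminal T = ∀ A → Σ[ t ∈ Hom A T ] (∀ (t' : Hom A T) → t' ≈ t)

  record IsRegular : Set (o ⊔ ℓ ⊔ e) where
    field
      terminal  : Σ[ T ∈ Obj ] IsTerminal T
      pullback  : ∀ {X Y Z} (f : Hom X Y) (g : Hom Z Y) →
                  Σ[ P ∈ Obj ] Σ[ p₁ ∈ Hom P X ] Σ[ p₂ ∈ Hom P Z ]
                    IsPullback f g p₁ p₂
      kernelPairCoeq : ∀ {K X Y} (f : Hom X Y) (a b : Hom K X) →
                  IsPullback f f a b →
                  Σ[ Q ∈ Obj ] Σ[ q ∈ Hom X Q ] IsCoequalizer a b q
      regEpiStable : ∀ {P X Y Z} (f : Hom X Y) (g : Hom Z Y)
                  (p₁ : Hom P X) (p₂ : Hom P Z) →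
                  IsPullback f g p₁ p₂ → RegularEpi f → RegularEpi p₂

  Class : (d : Level) → Set (o ⊔ ℓ ⊔ suc d)
  Class d = ∀ {X Y} → Hom X Y → Set d

  ClosedUnderPullback : ∀ {d} → Class d → Set (o ⊔ ℓ ⊔ e ⊔ d)
  ClosedUnderPullback 𝒟 = ∀ {P X Y Z} (f : Hom X Y) (g : Hom Z Y)
                  (p₁ : Hom P X) (p₂ : Hom P Z) →
                  IsPullback f g p₁ p₂ → 𝒟 f → 𝒟 p₂

  DefinableForCod : ∀ {d} → Class d → Set (o ⊔ ℓ ⊔ e ⊔ d)
  DefinableForCod 𝒟 =
    ClosedUnderPullback 𝒟 ×
    (∀ {X Y} (f : Hom X Y) →
      Σ[ U ∈ Obj ] Σ[ m ∈ Hom U Y ] (Mono m ×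
        (∀ {P Z} (g : Hom Z Y) (p₁ : Hom P X) (p₂ : Hom P Z) →
           IsPullback f g p₁ p₂ →
           (𝒟 p₂ ⇔ (Σ[ h ∈ Hom Z U ] (m ∘ h ≈ g))))))

{-# OPTIONS --safe #-}
module Submission where

-- The definability mono for f is its image m : Im f ↣ Y, where f = m ∘ q with q the coequalizer
-- of the kernel pair of f.  If g factors as m ∘ h, the square q, h is a pullback of the one for f
-- (since m is mono), so g*(f) is a pullback of the regular epi q.  Conversely, if g*(f) is a
-- regular epi, it is left orthogonal to the mono m, which produces the factorisation of g.
-- And m is mono because its kernel pair projections agree after precomposing
-- with the regular epi q × q, because the kernel pair of f is coequalized by q.

open import Level using (Level; _⊔_)
open import Data.Product using (Σ-syntax; _×_; _,_; proj₁; proj₂)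
open import Relation.Binary using (IsEquivalence; Setoid)
import Relation.Binary.Reasoning.Setoid as SetoidReasoning
open import Function.Bundles using (_⇔_; mk⇔)
open import Defs

module CategoryFacts {o ℓ e : Level} (𝔹 : Category o ℓ e) where
  open Category 𝔹
  open IsPullback
  open IsCoequalizer

  hom-setoid : Obj → Obj → Setoid ℓ e
  hom-setoid A B = record { Carrier = Hom A B ; _≈_ = _≈_ ; isEquivalence = ≈-equiv }

  module ≈ {A B : Obj} = IsEquivalence (≈-equiv {A} {B})
  module HomReasoning {A B : Obj} = SetoidReasoning (hom-setoid A B)
  open HomReasoning

  sym-assoc : ∀ {A B C D} {f : Hom C D} {g : Hom B C} {h : Hom A B} →
              f ∘ (g ∘ h) ≈ (f ∘ g) ∘ h
  sym-assoc = ≈.sym assoc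

  ∘-resp-≈ˡ : ∀ {A B C} {f f' : Hom B C} {g : Hom A B} → f ≈ f' → f ∘ g ≈ f' ∘ g
  ∘-resp-≈ˡ p = ∘-resp-≈ p ≈.refl

  ∘-resp-≈ʳ : ∀ {A B C} {f : Hom B C} {g g' : Hom A B} → g ≈ g' → f ∘ g ≈ f ∘ g'
  ∘-resp-≈ʳ p = ∘-resp-≈ ≈.refl p

  pullˡ : ∀ {A B C D} {a : Hom C D} {b : Hom B C} {c : Hom B D} {f : Hom A B} →
          a ∘ b ≈ c → a ∘ (b ∘ f) ≈ c ∘ f
  pullˡ ab≈c = ≈.trans sym-assoc (∘-resp-≈ˡ ab≈c)

  Epi : ∀ {X Y} → Hom X Y → Set (o ⊔ ℓ ⊔ e)
  Epi {Y = Y} p = ∀ {W} (u v : Hom Y W) → u ∘ p ≈ v ∘ p → u ≈ v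

  RegularEpi⇒Epi : ∀ {X Y} {p : Hom X Y} → RegularEpi 𝔹 p → Epi p
  RegularEpi⇒Epi {p = p} (_ , a , b , coeq) u v up≈vp =
    ≈.trans (unique u ≈.refl) (≈.sym (unique v (≈.sym up≈vp)))
    where
    up-coequalizes : (u ∘ p) ∘ a ≈ (u ∘ p) ∘ b
    up-coequalizes = begin
      (u ∘ p) ∘ a  ≈⟨ assoc ⟩
      u ∘ (p ∘ a)  ≈⟨ ∘-resp-≈ʳ (equality coeq) ⟩
      u ∘ (p ∘ b)  ≈⟨ sym-assoc ⟩
      (u ∘ p) ∘ b  ∎
    unique = proj₂ (proj₂ (coequalize coeq (u ∘ p) up-coequalizes))

  Epi-∘ : ∀ {X Y Z} {s : Hom Y Z} {t : Hom X Y} → Epi s → Epi t → Epi (s ∘ t)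
  Epi-∘ {s = s} {t} epi-s epi-t u v eq =
    epi-s u v (epi-t (u ∘ s) (v ∘ s) (≈.trans assoc (≈.trans eq sym-assoc)))

  kernelPair-equal⇒Mono : ∀ {K U Y} {m : Hom U Y} {c d : Hom K U} →
                          IsPullback 𝔹 m m c d → c ≈ d → Mono 𝔹 m
  kernelPair-equal⇒Mono kp c≈d u v mu≈mv
    with w , cw≈u , dw≈v , _ ← universal kp u v mu≈mv = begin
      u      ≈⟨ cw≈u ⟨
      _ ∘ w  ≈⟨ ∘-resp-≈ˡ c≈d ⟩
      _ ∘ w  ≈⟨ dw≈v ⟩
      v      ∎

  RegularEpi-lift-Mono : ∀ {P Z U Y} {p : Hom P Z} {m : Hom U Y} {u : Hom P U}
                         {g : Hom Z Y} → RegularEpi 𝔹 p → Mono 𝔹 m →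
                         m ∘ u ≈ g ∘ p → Σ[ h ∈ Hom Z U ] (m ∘ h ≈ g)
  RegularEpi-lift-Mono {p = p} {m} {u} {g} p-reg@(_ , a , b , coeq) mono mu≈gp =
    h , RegularEpi⇒Epi p-reg (m ∘ h) g mhp≈gp
    where
    mu-coequalizes : ∀ {W} (x : Hom W _) → m ∘ (u ∘ x) ≈ g ∘ (p ∘ x)
    mu-coequalizes x = ≈.trans (pullˡ mu≈gp) assoc
    u-coequalizes : u ∘ a ≈ u ∘ b
    u-coequalizes = mono _ _ (begin
      m ∘ (u ∘ a)  ≈⟨ mu-coequalizes a ⟩
      g ∘ (p ∘ a)  ≈⟨ ∘-resp-≈ʳ (equality coeq) ⟩
      g ∘ (p ∘ b)  ≈⟨ mu-coequalizes b ⟨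
      m ∘ (u ∘ b)  ∎)
    lift = coequalize coeq u u-coequalizes
    h = proj₁ lift
    mhp≈gp : (m ∘ h) ∘ p ≈ g ∘ p
    mhp≈gp = begin
      (m ∘ h) ∘ p  ≈⟨ assoc ⟩
      m ∘ (h ∘ p)  ≈⟨ ∘-resp-≈ʳ (proj₁ (proj₂ lift)) ⟩
      m ∘ u        ≈⟨ mu≈gp ⟩
      g ∘ p        ∎

  IsPullback-cancel-Mono : ∀ {P X Y Z U} {f : Hom X Y} {g : Hom Z Y} {q : Hom X U}
                           {h : Hom Z U} {m : Hom U Y} {p₁ : Hom P X} {p₂ : Hom P Z} →
                           Mono 𝔹 m → m ∘ q ≈ f → m ∘ h ≈ g →
                           IsPullback 𝔹 f g p₁ p₂ → IsPullback 𝔹 q h p₁ p₂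
  IsPullback-cancel-Mono {f = f} {g} {q} {h} {m} {p₁} {p₂} mono mq≈f mh≈g pb = record
    { commute   = mono _ _ (through-m (commute pb))
    ; universal = λ k₁ k₂ qk₁≈hk₂ → universal pb k₁ k₂ (from-m qk₁≈hk₂)
    }
    where
    from-m : ∀ {W} {k₁ : Hom W _} {k₂ : Hom W _} → q ∘ k₁ ≈ h ∘ k₂ → f ∘ k₁ ≈ g ∘ k₂
    from-m {k₁ = k₁} {k₂} qk₁≈hk₂ = begin
      f ∘ k₁        ≈⟨ ∘-resp-≈ˡ mq≈f ⟨
      (m ∘ q) ∘ k₁  ≈⟨ assoc ⟩
      m ∘ (q ∘ k₁)  ≈⟨ ∘-resp-≈ʳ qk₁≈hk₂ ⟩
      m ∘ (h ∘ k₂)  ≈⟨ pullˡ mh≈g ⟩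
      g ∘ k₂        ∎
    through-m : f ∘ p₁ ≈ g ∘ p₂ → m ∘ (q ∘ p₁) ≈ m ∘ (h ∘ p₂)
    through-m fp₁≈gp₂ = begin
      m ∘ (q ∘ p₁)  ≈⟨ pullˡ mq≈f ⟩
      f ∘ p₁        ≈⟨ fp₁≈gp₂ ⟩
      g ∘ p₂        ≈⟨ pullˡ mh≈g ⟨
      m ∘ (h ∘ p₂)  ∎

  record Image {X Y : Obj} (f : Hom X Y) : Set (o ⊔ ℓ ⊔ e) where
    field
      Im             : Obj
      cover          : Hom X Im
      inclusion      : Hom Im Y
      cover-regular  : RegularEpi 𝔹 cover
      inclusion-mono : Mono 𝔹 inclusion
      factors        : inclusion ∘ cover ≈ f

  DefinableForCod-RegularEpi : ClosedUnderPullback 𝔹 (RegularEpi 𝔹) →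
                               (∀ {X Y} (f : Hom X Y) → Image f) →
                               DefinableForCod 𝔹 (RegularEpi 𝔹)
  DefinableForCod-RegularEpi stable image = stable , definingMono
    where
    definingMono : ∀ {X Y} (f : Hom X Y) →
                   Σ[ U ∈ Obj ] Σ[ m ∈ Hom U Y ] (Mono 𝔹 m ×
                     (∀ {P Z} (g : Hom Z Y) (p₁ : Hom P X) (p₂ : Hom P Z) →
                        IsPullback 𝔹 f g p₁ p₂ →
                        (RegularEpi 𝔹 p₂ ⇔ (Σ[ h ∈ Hom Z U ] (m ∘ h ≈ g)))))
    definingMono f = Im , inclusion , inclusion-mono , λ g p₁ p₂ pb → mk⇔
      (λ p₂-reg → RegularEpi-lift-Mono p₂-reg inclusion-mono
                    (≈.trans (pullˡ factors) (commute pb)))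
      (λ (h , mh≈g) → stable cover h p₁ p₂
                        (IsPullback-cancel-Mono inclusion-mono factors mh≈g pb)
                        cover-regular)
      where open Image (image f)

module RegularCategoryFacts {o ℓ e : Level} (𝔹 : Category o ℓ e) (reg : IsRegular 𝔹) where
  open Category 𝔹
  open IsRegular reg
  open IsPullback
  open IsCoequalizer
  open CategoryFacts 𝔹
  open HomReasoning

  coequalizer-of-kernelPair-factor-Mono :
    ∀ {K X U Y} {f : Hom X Y} {a b : Hom K X} {q : Hom X U} {m : Hom U Y} →
    IsPullback 𝔹 f f a b → RegularEpi 𝔹 q → q ∘ a ≈ q ∘ b → m ∘ q ≈ f → Mono 𝔹 m
  coequalizer-of-kernelPair-factor-Mono {f = f} {a} {b} {q} {m} kp q-reg qa≈qb mq≈f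
    with _ , c , d , kp-m ← pullback m m
    with _ , r₁ , s₁ , pb₁ ← pullback q c
    with _ , r₂ , s₂ , pb₂ ← pullback q (d ∘ s₁)
    = kernelPair-equal⇒Mono kp-m c≈d
    where
    -- s₁ ∘ s₂ is q × q on the kernel pair of m, and (r₁ ∘ s₂ , r₂) lands in the kernel pair of f.
    fr₁s₂≈fr₂ : f ∘ (r₁ ∘ s₂) ≈ f ∘ r₂
    fr₁s₂≈fr₂ = begin
      f ∘ (r₁ ∘ s₂)        ≈⟨ ∘-resp-≈ˡ mq≈f ⟨
      (m ∘ q) ∘ (r₁ ∘ s₂)  ≈⟨ assoc ⟩
      m ∘ (q ∘ (r₁ ∘ s₂))  ≈⟨ ∘-resp-≈ʳ (pullˡ (commute pb₁)) ⟩
      m ∘ ((c ∘ s₁) ∘ s₂)  ≈⟨ pullˡ (pullˡ (commute kp-m)) ⟩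
      ((m ∘ d) ∘ s₁) ∘ s₂  ≈⟨ ∘-resp-≈ˡ assoc ⟩
      (m ∘ (d ∘ s₁)) ∘ s₂  ≈⟨ assoc ⟩
      m ∘ ((d ∘ s₁) ∘ s₂)  ≈⟨ ∘-resp-≈ʳ (commute pb₂) ⟨
      m ∘ (q ∘ r₂)         ≈⟨ pullˡ mq≈f ⟩
      f ∘ r₂               ∎
    t = universal kp (r₁ ∘ s₂) r₂ fr₁s₂≈fr₂
    at≈r₁s₂ = proj₁ (proj₂ t)
    bt≈r₂   = proj₁ (proj₂ (proj₂ t))
    cs≈ds : c ∘ (s₁ ∘ s₂) ≈ d ∘ (s₁ ∘ s₂)
    cs≈ds = begin
      c ∘ (s₁ ∘ s₂)        ≈⟨ sym-assoc ⟩
      (c ∘ s₁) ∘ s₂        ≈⟨ pullˡ (commute pb₁) ⟨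
      q ∘ (r₁ ∘ s₂)        ≈⟨ ∘-resp-≈ʳ at≈r₁s₂ ⟨
      q ∘ (a ∘ proj₁ t)    ≈⟨ pullˡ qa≈qb ⟩
      (q ∘ b) ∘ proj₁ t    ≈⟨ assoc ⟩
      q ∘ (b ∘ proj₁ t)    ≈⟨ ∘-resp-≈ʳ bt≈r₂ ⟩
      q ∘ r₂               ≈⟨ commute pb₂ ⟩
      (d ∘ s₁) ∘ s₂        ≈⟨ assoc ⟩
      d ∘ (s₁ ∘ s₂)        ∎
    c≈d : c ≈ d
    c≈d = Epi-∘ (RegularEpi⇒Epi (regEpiStable q c r₁ s₁ pb₁ q-reg))
                (RegularEpi⇒Epi (regEpiStable q (d ∘ s₁) r₂ s₂ pb₂ q-reg))
                c d cs≈ds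

  image : ∀ {X Y} (f : Hom X Y) → Image f
  image f
    with _ , a , b , kp ← pullback f f
    with Q , q , coeq ← kernelPairCoeq f a b kp
    with m , mq≈f , _ ← coequalize coeq f (commute kp)
    = record
      { Im             = Q
      ; cover          = q
      ; inclusion      = m
      ; cover-regular  = _ , a , b , coeq
      ; inclusion-mono = coequalizer-of-kernelPair-factor-Mono kp (_ , a , b , coeq)
                           (equality coeq) mq≈f
      ; factors        = mq≈f
      }

mainTheorem8 : ∀ {o ℓ e : Level} (𝔹 : Category o ℓ e) → IsRegular 𝔹 →
    DefinableForCod 𝔹 (RegularEpi 𝔹)
mainTheorem8 𝔹 reg =
  CategoryFacts.DefinableForCod-RegularEpi 𝔹 (IsRegular.regEpiStable reg)
    (RegularCategoryFacts.image 𝔹 reg)
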